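{- The worst-case merge cost of $2$-merge sort is $\ge (c_2-o(1))\, n\log n$, where $c_2=3/\log(27/4)\approx 1.08897$: for every $\varepsilon>0$ and every $N$ there is an input of total length $n\ge N$ on which the merge cost of $2$-merge sort is at least $(c_2-\varepsilon)\, n\log n$.
   Context: Model: an input is identified with its sequence $\langle n_1,\dots,n_m\rangle$ of positive integer run lengths; $n=\sum_i n_i$ is the input length, $m$ the number of original runs. The algorithm maintains a stack $Q_1,\dots,Q_\ell$ of runs (represented by their lengths), top $Q_\ell$; $X,Y,Z$ denote $Q_{\ell-2},Q_{\ell-1},Q_\ell$ when they exist, and any test involving a nonexistent stack element evaluates to false. "Push" removes the next original run (left to right) and pushes it. "Merge $Y$ and $Z$" replaces the top two runs by one run of length $|Y|+|Z|$; "merge $X$ and $Y$" replaces the second and third runs from the top by one run of length $|X|+|Y|$. A merge of runs $A,B$ costs $|A|+|B|$; the merge cost is the total cost of all merges performed. $\log$ is base 2. $2$-merge sort: while original runs remain: push the next run; then while $|Y|<2|Z|$: if $|X|<|Z|$ merge $X$ and $Y$, else merge $Y$ and $Z$. After all runs are pushed, repeatedly merge $Y$ and $Z$ until one run remains. -}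

module Defs where

open import Data.Nat using (ℕ; zero; suc; _+_; _*_; _<ᵇ_)
open import Data.Bool using (Bool; true; false; if_then_else_)
open import Data.List using (List; []; _∷_; length)
open import Data.Product using (_×_; _,_)

-- The stack is a list whose HEAD is the top Q_ℓ (= Z), then Y, then X, ...
-- A state of the run is a pair (stack , accumulated merge cost).

-- Inner loop of 2-merge sort: while |Y| < 2|Z| :
--   if |X| < |Z| merge X and Y, else merge Y and Z.
-- (A test involving a nonexistent X is false, so with no X we merge Y,Z.)
-- The fuel argument only ensures termination: each merge shortens the
-- stack, so fuel = length of the stack is always sufficient.
mergeLoop : ℕ → List ℕ → ℕ → List ℕ × ℕ
mergeLoop zero s c = s , c
mergeLoop (suc f) (z ∷ y ∷ rest) c with y <ᵇ 2 * z
... | false = (z ∷ y ∷ rest) , c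
mergeLoop (suc f) (z ∷ y ∷ []) c | true =
  mergeLoop f ((y + z) ∷ []) (c + (y + z))
mergeLoop (suc f) (z ∷ y ∷ x ∷ rest) c | true =
  if x <ᵇ z
  then mergeLoop f (z ∷ (x + y) ∷ rest) (c + (x + y))
  else mergeLoop f ((y + z) ∷ x ∷ rest) (c + (y + z))
mergeLoop (suc f) s c = s , c

pushPhase : List ℕ → List ℕ → ℕ → List ℕ × ℕ
pushPhase [] s c = s , c
pushPhase (r ∷ rs) s c with mergeLoop (length (r ∷ s)) (r ∷ s) c
... | s' , c' = pushPhase rs s' c'

finalPhase : ℕ → List ℕ → ℕ → ℕ
finalPhase zero s c = c
finalPhase (suc f) (z ∷ y ∷ rest) c = finalPhase f ((y + z) ∷ rest) (c + (y + z))
finalPhase (suc f) s c = c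

twoMergeCost : List ℕ → ℕ
twoMergeCost runs with pushPhase runs [] 0
... | s , c = finalPhase (length s) s c

-- A run of length m ≥ 6 is replaced by a hard input of length p ≈ 2m/3
-- followed by one of length q = m − p. 2-merge sort treats each part as a
-- single run and then merges the two, so the cost obeys C(m) = C(p) + C(q) + m.
-- The entropy bound m^m 2^p ≤ 3^m p^p q^q and 27^a ≤ 2^(2a+3b) then give,
-- by induction, m^(am) ≤ 2^(b C(m)) K^m for a constant K. A strict inequality
-- 27^a < 2^(2a+3b) survives amplification to (at + 1, bt), and the extra
-- factor n^n swallows K^n for large n.

module Submission where

open import Defs
open import Data.Bool using (true; false)
open import Data.List using (List; []; _∷_; length; _++_)
open import Data.List.Relation.Unary.All using (All; []; _∷_)
open import Data.List.Relation.Unary.All.Properties using (++⁺)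
open import Data.Nat
open import Data.Nat.DivMod using (_/_; _%_; m≡m%n+[m/n]*n; m%n<n)
open import Data.Nat.ListAction using (sum)
open import Data.Nat.ListAction.Properties using (sum-++)
open import Data.Nat.Properties
open import Data.Nat.Tactic.RingSolver using (solve-∀)
open import Data.Product using (_×_; _,_; ∃-syntax; uncurry)
open import Data.Sum using ([_,_]′)
open import Data.Unit using (⊤)
open import Relation.Binary.PropositionalEquality
open import Relation.Nullary using (yes; no; contradiction)

-- Weighted AM–GM and the entropy bound

^-distribʳ-* : ∀ m n o → (m * n) ^ o ≡ m ^ o * n ^ o
^-distribʳ-* m n zero = refl
^-distribʳ-* m n (suc o) = begin
  m * n * (m * n) ^ o     ≡⟨ cong (m * n *_) (^-distribʳ-* m n o) ⟩
  m * n * (m ^ o * n ^ o) ≡⟨ [m*n]*[o*p]≡[m*o]*[n*p] m n (m ^ o) (n ^ o) ⟩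
  m * m ^ o * (n * n ^ o) ∎
  where open ≡-Reasoning

[m^n]^o≡[m^o]^n : ∀ m n o → (m ^ n) ^ o ≡ (m ^ o) ^ n
[m^n]^o≡[m^o]^n m n o = begin
  (m ^ n) ^ o ≡⟨ ^-*-assoc m n o ⟩
  m ^ (n * o) ≡⟨ cong (m ^_) (*-comm n o) ⟩
  m ^ (o * n) ≡⟨ ^-*-assoc m o n ⟨
  (m ^ o) ^ n ∎
  where open ≡-Reasoning

n^n>0 : ∀ n → 0 < n ^ n
n^n>0 zero = z<s
n^n>0 n@(suc _) = m^n>0 n n

^-cancelʳ-≤ : ∀ {m o} n .{{_ : NonZero n}} → m ^ n ≤ o ^ n → m ≤ o
^-cancelʳ-≤ n mⁿ≤oⁿ = ≮⇒≥ (λ o<m → <⇒≱ (^-monoˡ-< n o<m) mⁿ≤oⁿ)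

2*m*n≤m*m+n*n : ∀ m n → 2 * m * n ≤ m * m + n * n
2*m*n≤m*m+n*n m n = [ ordered , flipped ]′ (≤-total m n)
  where
    ordered : ∀ {x y} → x ≤ y → 2 * x * y ≤ x * x + y * y
    ordered {x} x≤y with m≤n⇒∃[o]m+o≡n x≤y
    ... | d , refl = begin
      2 * x * (x + d)                 ≤⟨ m≤m+n _ (d * d) ⟩
      2 * x * (x + d) + d * d         ≡⟨ square x d ⟩
      x * x + (x + d) * (x + d)       ∎
      where
        open ≤-Reasoning
        square : ∀ x d → 2 * x * (x + d) + d * d ≡ x * x + (x + d) * (x + d)
        square = solve-∀
    flipped : n ≤ m → 2 * m * n ≤ m * m + n * n
    flipped n≤m = subst₂ _≤_ (swap n m) (+-comm (n * n) (m * m)) (ordered n≤m)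
      where
        swap : ∀ n m → 2 * n * m ≡ 2 * m * n
        swap = solve-∀

[1+m]*y*z^m≤y^[1+m]+m*z^[1+m] : ∀ m y z → suc m * y * z ^ m ≤ y ^ suc m + m * z ^ suc m
[1+m]*y*z^m≤y^[1+m]+m*z^[1+m] zero y z = ≤-reflexive (base y)
  where
    base : ∀ y → 1 * y * 1 ≡ y * 1 + 0
    base = solve-∀
[1+m]*y*z^m≤y^[1+m]+m*z^[1+m] (suc m) y z = +-cancelʳ-≤ (m * y * (z * A)) _ _ (begin
  suc (suc m) * y * (z * A) + m * y * (z * A) ≡⟨ regroup₁ m y z A ⟩
  suc m * (2 * y * z) * A                      ≤⟨ *-monoˡ-≤ A (*-monoʳ-≤ (suc m) (2*m*n≤m*m+n*n y z)) ⟩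
  suc m * (y * y + z * z) * A                  ≡⟨ regroup₂ m y z A ⟩
  suc m * y * A * y + suc m * (z * (z * A))    ≤⟨ +-monoˡ-≤ _ (*-monoˡ-≤ y ih) ⟩
  (B + m * (z * A)) * y + suc m * (z * (z * A)) ≡⟨ regroup₃ m y z A B ⟩
  y * B + suc m * (z * (z * A)) + m * y * (z * A) ∎)
  where
    open ≤-Reasoning
    A = z ^ m
    B = y ^ suc m
    ih : suc m * y * A ≤ B + m * (z * A)
    ih = [1+m]*y*z^m≤y^[1+m]+m*z^[1+m] m y z
    regroup₁ : ∀ m y z A → suc (suc m) * y * (z * A) + m * y * (z * A) ≡ suc m * (2 * y * z) * A
    regroup₁ = solve-∀
    regroup₂ : ∀ m y z A → suc m * (y * y + z * z) * A ≡ suc m * y * A * y + suc m * (z * (z * A))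
    regroup₂ = solve-∀
    regroup₃ : ∀ m y z A B → (B + m * (z * A)) * y + suc m * (z * (z * A)) ≡ y * B + suc m * (z * (z * A)) + m * y * (z * A)
    regroup₃ = solve-∀

[1+w]^[1+w]*s^w*x≤w^w*[s+x]^[1+w] : ∀ w s x → suc w ^ suc w * s ^ w * x ≤ w ^ w * (s + x) ^ suc w
[1+w]^[1+w]*s^w*x≤w^w*[s+x]^[1+w] zero s x = begin
  x + 0 * x       ≡⟨ cong (x +_) (*-zeroˡ x) ⟩
  x + 0           ≡⟨ +-identityʳ x ⟩
  x               ≤⟨ m≤n+m x s ⟩
  s + x           ≡⟨ *-identityʳ (s + x) ⟨
  (s + x) * 1     ≡⟨ *-identityˡ _ ⟨
  1 * ((s + x) * 1) ∎
  where open ≤-Reasoning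
[1+w]^[1+w]*s^w*x≤w^w*[s+x]^[1+w] w@(suc _) s x =
  *-cancelˡ-≤ w (+-cancelˡ-≤ (w * (z * (P * S))) _ _ (begin
    w * (z * (P * S)) + w * (suc w ^ suc w * s ^ w * x) ≡⟨ regroup₁ w s x P S ⟩
    suc w * y * (P * S)                               ≡⟨ cong (suc w * y *_) (^-distribʳ-* (suc w) s w) ⟨
    suc w * y * z ^ w                                 ≤⟨ [1+m]*y*z^m≤y^[1+m]+m*z^[1+m] w y z ⟩
    y ^ suc w + w * z ^ suc w                         ≡⟨ cong₂ (λ u v → u + w * (z * v)) (^-distribʳ-* w (s + x) (suc w)) (^-distribʳ-* (suc w) s w) ⟩
    w ^ suc w * (s + x) ^ suc w + w * (z * (P * S))   ≡⟨ regroup₂ w (w ^ w) ((s + x) ^ suc w) (w * (z * (P * S))) ⟩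
    w * (z * (P * S)) + w * (w ^ w * (s + x) ^ suc w) ∎))
  where
    open ≤-Reasoning
    P = suc w ^ w
    S = s ^ w
    y = w * (s + x)
    z = suc w * s
    regroup₁ : ∀ w s x P S → w * (suc w * s * (P * S)) + w * (suc w * P * S * x) ≡ suc w * (w * (s + x)) * (P * S)
    regroup₁ = solve-∀
    regroup₂ : ∀ w V R K → w * V * R + K ≡ K + w * (V * R)
    regroup₂ = solve-∀

weighted-am-gm : ∀ q p u v → (q + p) ^ (q + p) * (u ^ q * v ^ p) ≤ (q * u + p * v) ^ (q + p)
weighted-am-gm q zero u v rewrite +-identityʳ q | *-identityʳ (u ^ q) | +-identityʳ (q * u) =
  ≤-reflexive (sym (^-distribʳ-* q u q))
weighted-am-gm q (suc p) u v rewrite +-suc q p =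
  *-cancelˡ-≤ (w ^ w) {{>-nonZero (n^n>0 w)}} (begin
    w ^ w * (suc w ^ suc w * (u ^ q * (v * v ^ p))) ≡⟨ regroup₁ (w ^ w) (suc w ^ suc w) (u ^ q) v (v ^ p) ⟩
    suc w ^ suc w * v * (w ^ w * (u ^ q * v ^ p))   ≤⟨ *-monoʳ-≤ (suc w ^ suc w * v) (weighted-am-gm q p u v) ⟩
    suc w ^ suc w * v * s ^ w                       ≡⟨ regroup₂ (suc w ^ suc w) v (s ^ w) ⟩
    suc w ^ suc w * s ^ w * v                       ≤⟨ [1+w]^[1+w]*s^w*x≤w^w*[s+x]^[1+w] w s v ⟩
    w ^ w * (s + v) ^ suc w                         ≡⟨ cong (λ t → w ^ w * t ^ suc w) (shift q p u v) ⟨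
    w ^ w * (q * u + suc p * v) ^ suc w             ∎)
  where
    open ≤-Reasoning
    w = q + p
    s = q * u + p * v
    shift : ∀ q p u v → q * u + suc p * v ≡ (q * u + p * v) + v
    shift = solve-∀
    regroup₁ : ∀ A B C v D → A * (B * (C * (v * D))) ≡ B * v * (A * (C * D))
    regroup₁ = solve-∀
    regroup₂ : ∀ A v C → A * v * C ≡ A * C * v
    regroup₂ = solve-∀

-- With n = q + p this is H(p/n) + p/n ≤ log 3 for the binary entropy H,
-- with equality at p = 2q, the split ratio of the inputs built below.
entropy-bound : ∀ q p → 1 ≤ q → 1 ≤ p → (q + p) ^ (q + p) * 2 ^ p ≤ 3 ^ (q + p) * (p ^ p * q ^ q)
entropy-bound q p 1≤q 1≤p = *-cancelˡ-≤ K {{>-nonZero K>0}} (begin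
  K * (N * 2 ^ p)                               ≡⟨ cong (λ t → K * (t * 2 ^ p)) (^-distribˡ-+-* n q p) ⟩
  K * ((n ^ q * n ^ p) * 2 ^ p)                 ≡⟨ regroup₁ N (n ^ q) (n ^ p) (p ^ q) (q ^ p) (2 ^ p) ⟩
  N * ((n ^ q * p ^ q) * ((2 ^ p * n ^ p) * q ^ p)) ≡⟨ cong₂ (λ s t → N * (s * (t * q ^ p))) (^-distribʳ-* n p q) (^-distribʳ-* 2 n p) ⟨
  N * ((n * p) ^ q * ((2 * n) ^ p * q ^ p))     ≡⟨ cong (λ t → N * ((n * p) ^ q * t)) (^-distribʳ-* (2 * n) q p) ⟨
  N * ((n * p) ^ q * (2 * n * q) ^ p)           ≤⟨ weighted-am-gm q p (n * p) (2 * n * q) ⟩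
  (q * (n * p) + p * (2 * n * q)) ^ n           ≡⟨ cong (_^ n) (regroup₂ n p q) ⟩
  (3 * n * (p * q)) ^ n                         ≡⟨ ^-distribʳ-* (3 * n) (p * q) n ⟩
  (3 * n) ^ n * (p * q) ^ n                     ≡⟨ cong₂ _*_ (^-distribʳ-* 3 n n) (^-distribʳ-* p q n) ⟩
  3 ^ n * N * (p ^ n * q ^ n)                   ≡⟨ cong₂ (λ s t → 3 ^ n * N * (s * t)) (^-distribˡ-+-* p q p) (^-distribˡ-+-* q q p) ⟩
  3 ^ n * N * ((p ^ q * p ^ p) * (q ^ q * q ^ p)) ≡⟨ regroup₃ (3 ^ n) N (p ^ q) (p ^ p) (q ^ q) (q ^ p) ⟩
  K * (3 ^ n * (p ^ p * q ^ q))                 ∎)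
  where
    open ≤-Reasoning
    n = q + p
    N = n ^ n
    K = N * p ^ q * q ^ p
    K>0 : 0 < K
    K>0 = *-mono-< (*-mono-< (n^n>0 n) (m^n>0 p {{>-nonZero 1≤p}} q)) (m^n>0 q {{>-nonZero 1≤q}} p)
    regroup₁ : ∀ N a b c d t → N * c * d * ((a * b) * t) ≡ N * ((a * c) * ((t * b) * d))
    regroup₁ = solve-∀
    regroup₂ : ∀ n p q → q * (n * p) + p * (2 * n * q) ≡ 3 * n * (p * q)
    regroup₂ = solve-∀
    regroup₃ : ∀ T N a b c d → T * N * ((a * b) * (c * d)) ≡ N * a * d * (T * (b * c))
    regroup₃ = solve-∀

-- Splitting a run into two thirds and one third

small : ℕ → ℕ
small m = m / 3 + 1

large : ℕ → ℕ
large m = m ∸ small m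

record ThirdSplit (m : ℕ) : Set where
  field
    r j : ℕ
    r≤2 : r ≤ 2
    m≡ : m ≡ r + 3 * suc (suc j)
    m/3≡ : m / 3 ≡ suc (suc j)

thirdSplit : ∀ m → 6 ≤ m → ThirdSplit m
thirdSplit m 6≤m = split (m / 3) refl
  where
    m≡ : ∀ {k} → m / 3 ≡ k → m ≡ m % 3 + 3 * k
    m≡ {k} m/3≡k = begin
      m                   ≡⟨ m≡m%n+[m/n]*n m 3 ⟩
      m % 3 + m / 3 * 3   ≡⟨ cong (λ t → m % 3 + t) (*-comm (m / 3) 3) ⟩
      m % 3 + 3 * (m / 3) ≡⟨ cong (λ t → m % 3 + 3 * t) m/3≡k ⟩
      m % 3 + 3 * k       ∎
      where open ≡-Reasoning
    m<6 : ∀ {k} → m / 3 ≡ k → k ≤ 1 → m < 6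
    m<6 {k} m/3≡k k≤1 = begin-strict
      m               ≡⟨ m≡ m/3≡k ⟩
      m % 3 + 3 * k   <⟨ +-monoˡ-< (3 * k) (m%n<n m 3) ⟩
      3 + 3 * k       ≡⟨ *-suc 3 k ⟨
      3 * suc k       ≤⟨ *-monoʳ-≤ 3 (s≤s k≤1) ⟩
      6               ∎
      where open ≤-Reasoning
    split : ∀ k → m / 3 ≡ k → ThirdSplit m
    split 0 m/3≡0 = contradiction 6≤m (<⇒≱ (m<6 m/3≡0 z≤n))
    split 1 m/3≡1 = contradiction 6≤m (<⇒≱ (m<6 m/3≡1 ≤-refl))
    split (suc (suc j)) m/3≡k = record
      { r = m % 3 ; j = j ; r≤2 = ≤-pred (m%n<n m 3) ; m≡ = m≡ m/3≡k ; m/3≡ = m/3≡k }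

0<small : ∀ m → 0 < small m
0<small m = m≤n+m 1 (m / 3)

module _ {m : ℕ} (6≤m : 6 ≤ m) where
  open ThirdSplit (thirdSplit m 6≤m)

  private
    m≡large+small : m ≡ (r + 2 * j + 3) + (j + 3)
    m≡large+small = trans m≡ (regroup r j)
      where
        regroup : ∀ r j → r + 3 * suc (suc j) ≡ r + 2 * j + 3 + (j + 3)
        regroup = solve-∀

  small≡ : small m ≡ j + 3
  small≡ = trans (cong (_+ 1) m/3≡) (trans (+-comm (suc (suc j)) 1) (+-comm 3 j))

  large≡ : large m ≡ r + 2 * j + 3
  large≡ = trans (cong₂ _∸_ m≡large+small small≡) (m+n∸n≡m (r + 2 * j + 3) (j + 3))

  large+small≡m : large m + small m ≡ m
  large+small≡m rewrite large≡ | small≡ = sym m≡large+small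

  0<large : 0 < large m
  0<large rewrite large≡ = ≤-trans (s≤s z≤n) (m≤n+m 3 (r + 2 * j))

  large<2*small : large m < 2 * small m
  large<2*small rewrite large≡ | small≡ = begin-strict
    r + 2 * j + 3       ≡⟨ +-assoc r (2 * j) 3 ⟩
    r + (2 * j + 3)     <⟨ +-monoˡ-< (2 * j + 3) (s≤s r≤2) ⟩
    3 + (2 * j + 3)     ≡⟨ regroup j ⟩
    2 * (j + 3)         ∎
    where
      open ≤-Reasoning
      regroup : ∀ j → 3 + (2 * j + 3) ≡ 2 * (j + 3)
      regroup = solve-∀

  small≤2*large : small m ≤ 2 * large m
  small≤2*large rewrite large≡ | small≡ = begin
    j + 3                           ≤⟨ m≤m+n (j + 3) (2 * r + 3 * j + 3) ⟩
    j + 3 + (2 * r + 3 * j + 3)     ≡⟨ regroup r j ⟩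
    2 * (r + 2 * j + 3)             ∎
    where
      open ≤-Reasoning
      regroup : ∀ r j → j + 3 + (2 * r + 3 * j + 3) ≡ 2 * (r + 2 * j + 3)
      regroup = solve-∀

  large<m : large m < m
  large<m = begin-strict
    large m           <⟨ m<m+n (large m) (0<small m) ⟩
    large m + small m ≡⟨ large+small≡m ⟩
    m                 ∎
    where open ≤-Reasoning

  small<m : small m < m
  small<m = begin-strict
    small m           <⟨ m<n+m (small m) 0<large ⟩
    large m + small m ≡⟨ large+small≡m ⟩
    m                 ∎
    where open ≤-Reasoning

  3*[m/3]≤m : 3 * (m / 3) ≤ m
  3*[m/3]≤m = begin
    3 * (m / 3)           ≡⟨ cong (3 *_) m/3≡ ⟩
    3 * suc (suc j)       ≤⟨ m≤n+m _ r ⟩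
    r + 3 * suc (suc j)   ≡⟨ m≡ ⟨
    m                     ∎
    where open ≤-Reasoning

  2*[m/3]≤large+1 : 2 * (m / 3) ≤ large m + 1
  2*[m/3]≤large+1 = begin
    2 * (m / 3)               ≡⟨ cong (2 *_) m/3≡ ⟩
    2 * suc (suc j)           ≤⟨ m≤m+n _ r ⟩
    2 * suc (suc j) + r       ≡⟨ regroup r j ⟩
    r + 2 * j + 3 + 1         ≡⟨ cong (_+ 1) large≡ ⟨
    large m + 1               ∎
    where
      open ≤-Reasoning
      regroup : ∀ r j → 2 * suc (suc j) + r ≡ r + 2 * j + 3 + 1
      regroup = solve-∀

  3^m≤9*27^[m/3] : 3 ^ m ≤ 9 * 27 ^ (m / 3)
  3^m≤9*27^[m/3] = begin
    3 ^ m                 ≡⟨ cong (3 ^_) m≡ ⟩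
    3 ^ (r + 3 * k)       ≡⟨ ^-distribˡ-+-* 3 r (3 * k) ⟩
    3 ^ r * 3 ^ (3 * k)   ≡⟨ cong (3 ^ r *_) (^-*-assoc 3 3 k) ⟨
    3 ^ r * 27 ^ k        ≤⟨ *-monoˡ-≤ (27 ^ k) (^-monoʳ-≤ 3 r≤2) ⟩
    9 * 27 ^ k            ≡⟨ cong (λ t → 9 * 27 ^ t) m/3≡ ⟨
    9 * 27 ^ (m / 3)      ∎
    where
      open ≤-Reasoning
      k = suc (suc j)

2*large[small]≤large : ∀ {m} (6≤m : 6 ≤ m) → 6 ≤ small m → 2 * large (small m) ≤ large m
2*large[small]≤large {m} 6≤m 6≤small = begin
  2 * large (small m)                            ≡⟨ cong (2 *_) (large≡ 6≤small) ⟩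
  2 * (r′ + 2 * j′ + 3)                          ≤⟨ m≤n+m _ (r + 2 * j′ + 3) ⟩
  r + 2 * j′ + 3 + 2 * (r′ + 2 * j′ + 3)         ≡⟨ regroup r r′ j′ ⟩
  r + 2 * (r′ + 3 * j′ + 3) + 3                  ≡⟨ cong (λ t → r + 2 * t + 3) j≡ ⟨
  r + 2 * j + 3                                  ≡⟨ large≡ 6≤m ⟨
  large m                                        ∎
  where
    open ≤-Reasoning
    open ThirdSplit (thirdSplit m 6≤m)
    open ThirdSplit (thirdSplit (small m) 6≤small) using () renaming (r to r′; j to j′; m≡ to small≡′)
    regroup : ∀ r r′ j′ → r + 2 * j′ + 3 + 2 * (r′ + 2 * j′ + 3) ≡ r + 2 * (r′ + 3 * j′ + 3) + 3
    regroup = solve-∀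
    split : ∀ r′ j′ → r′ + 3 * suc (suc j′) ≡ r′ + 3 * j′ + 3 + 3
    split = solve-∀
    j≡ : j ≡ r′ + 3 * j′ + 3
    j≡ = +-cancelʳ-≡ 3 j _ (trans (sym (small≡ 6≤m)) (trans small≡′ (split r′ j′)))

-- 2-merge sort on the hard inputs

infix 4 _≤top_
_≤top_ : ℕ → List ℕ → Set
k ≤top []      = ⊤
k ≤top (x ∷ _) = k ≤ x

≤top-trans : ∀ {k k′} W → k ≤ k′ → k′ ≤top W → k ≤top W
≤top-trans []      _    _  = _
≤top-trans (_ ∷ _) k≤k′ k′≤x = ≤-trans k≤k′ k′≤x

<⇒<ᵇ≡true : ∀ {m n} → m < n → (m <ᵇ n) ≡ true
<⇒<ᵇ≡true {zero}  {suc n} _         = refl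
<⇒<ᵇ≡true {suc m} {suc n} (s≤s m<n) = <⇒<ᵇ≡true m<n

≤⇒<ᵇ≡false : ∀ {m n} → n ≤ m → (m <ᵇ n) ≡ false
≤⇒<ᵇ≡false {m}     {zero}  _         = refl
≤⇒<ᵇ≡false {suc m} {suc n} (s≤s n≤m) = ≤⇒<ᵇ≡false n≤m

mergeLoop-stop : ∀ z W c → 2 * z ≤top W → mergeLoop (suc (length W)) (z ∷ W) c ≡ (z ∷ W , c)
mergeLoop-stop z []      c _     = refl
mergeLoop-stop z (y ∷ _) c 2z≤y rewrite ≤⇒<ᵇ≡false 2z≤y = refl

mergeLoop-mergeYZ : ∀ z y W c → y < 2 * z → z ≤top W →
  mergeLoop (suc (suc (length W))) (z ∷ y ∷ W) c ≡ mergeLoop (suc (length W)) (y + z ∷ W) (c + (y + z))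
mergeLoop-mergeYZ z y []      c y<2z _   rewrite <⇒<ᵇ≡true y<2z = refl
mergeLoop-mergeYZ z y (x ∷ _) c y<2z z≤x rewrite <⇒<ᵇ≡true y<2z | ≤⇒<ᵇ≡false z≤x = refl

pushPhase-++ : ∀ xs ys s c → pushPhase (xs ++ ys) s c ≡ uncurry (pushPhase ys) (pushPhase xs s c)
pushPhase-++ []       ys s c = refl
pushPhase-++ (r ∷ xs) ys s c with mergeLoop (suc (length s)) (r ∷ s) c
... | s′ , c′ = pushPhase-++ xs ys s′ c′

pushPhase-singleton : ∀ m W c → pushPhase (m ∷ []) W c ≡ mergeLoop (suc (length W)) (m ∷ W) (c + 0)
pushPhase-singleton m W c rewrite +-identityʳ c with mergeLoop (suc (length W)) (m ∷ W) c
... | s′ , c′ = refl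

-- The fuel f only ensures termination; f ≥ m suffices since both parts are
-- shorter than m.
hardRuns : ℕ → ℕ → List ℕ
hardRuns zero    m = m ∷ []
hardRuns (suc f) m with m <? 6
... | yes _ = m ∷ []
... | no  _ = hardRuns f (large m) ++ hardRuns f (small m)

hardCost : ℕ → ℕ → ℕ
hardCost zero    m = 0
hardCost (suc f) m with m <? 6
... | yes _ = 0
... | no  _ = hardCost f (large m) + hardCost f (small m) + m

-- The first part stays above W; once the second part has collapsed to a
-- single run, the loop merges the two parts as Y and Z.
pushPhase-hardRuns : ∀ f m W c → (6 ≤ m → 2 * large m ≤top W) →
  pushPhase (hardRuns f m) W c ≡ mergeLoop (suc (length W)) (m ∷ W) (c + hardCost f m)
pushPhase-hardRuns zero m W c _ = pushPhase-singleton m W c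
pushPhase-hardRuns (suc f) m W c top with m <? 6
... | yes _ = pushPhase-singleton m W c
... | no m≮6 = begin
  pushPhase (hardRuns f p ++ hardRuns f q) W c
    ≡⟨ pushPhase-++ (hardRuns f p) (hardRuns f q) W c ⟩
  uncurry (pushPhase (hardRuns f q)) (pushPhase (hardRuns f p) W c)
    ≡⟨ cong (uncurry (pushPhase (hardRuns f q))) (pushPhase-hardRuns f p W c topₚ) ⟩
  uncurry (pushPhase (hardRuns f q)) (mergeLoop (suc (length W)) (p ∷ W) (c + Cp))
    ≡⟨ cong (uncurry (pushPhase (hardRuns f q))) (mergeLoop-stop p W _ (top 6≤m)) ⟩
  pushPhase (hardRuns f q) (p ∷ W) (c + Cp)
    ≡⟨ pushPhase-hardRuns f q (p ∷ W) _ (2*large[small]≤large 6≤m) ⟩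
  mergeLoop (suc (suc (length W))) (q ∷ p ∷ W) (c + Cp + Cq)
    ≡⟨ mergeLoop-mergeYZ q p W _ (large<2*small 6≤m) (≤top-trans W (small≤2*large 6≤m) (top 6≤m)) ⟩
  mergeLoop (suc (length W)) (p + q ∷ W) (c + Cp + Cq + (p + q))
    ≡⟨ cong₂ (λ s t → mergeLoop (suc (length W)) (s ∷ W) (c + Cp + Cq + t)) p+q≡m p+q≡m ⟩
  mergeLoop (suc (length W)) (m ∷ W) (c + Cp + Cq + m)
    ≡⟨ cong (mergeLoop (suc (length W)) (m ∷ W)) (trans (cong (_+ m) (+-assoc c Cp Cq)) (+-assoc c (Cp + Cq) m)) ⟩
  mergeLoop (suc (length W)) (m ∷ W) (c + (Cp + Cq + m)) ∎
  where
    open ≡-Reasoning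
    6≤m : 6 ≤ m
    6≤m = ≮⇒≥ m≮6
    p = large m
    q = small m
    Cp = hardCost f p
    Cq = hardCost f q
    p+q≡m : p + q ≡ m
    p+q≡m = large+small≡m 6≤m
    topₚ : 6 ≤ p → 2 * large p ≤top W
    topₚ _ = ≤top-trans W (*-monoʳ-≤ 2 (m∸n≤m p (small p))) (top 6≤m)

twoMergeCost-hardRuns : ∀ f m → twoMergeCost (hardRuns f m) ≡ hardCost f m
twoMergeCost-hardRuns f m rewrite pushPhase-hardRuns f m [] 0 (λ _ → _) = refl

sum-hardRuns : ∀ f m → sum (hardRuns f m) ≡ m
sum-hardRuns zero    m = +-identityʳ m
sum-hardRuns (suc f) m with m <? 6
... | yes _   = +-identityʳ m
... | no m≮6  = begin
  sum (hardRuns f (large m) ++ hardRuns f (small m))         ≡⟨ sum-++ (hardRuns f (large m)) (hardRuns f (small m)) ⟩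
  sum (hardRuns f (large m)) + sum (hardRuns f (small m))    ≡⟨ cong₂ _+_ (sum-hardRuns f (large m)) (sum-hardRuns f (small m)) ⟩
  large m + small m                                          ≡⟨ large+small≡m (≮⇒≥ m≮6) ⟩
  m                                                          ∎
  where open ≡-Reasoning

hardRuns-positive : ∀ f m → 1 ≤ m → All (1 ≤_) (hardRuns f m)
hardRuns-positive zero    m 1≤m = 1≤m ∷ []
hardRuns-positive (suc f) m 1≤m with m <? 6
... | yes _  = 1≤m ∷ []
... | no m≮6 = ++⁺ (hardRuns-positive f (large m) (0<large (≮⇒≥ m≮6)))
                   (hardRuns-positive f (small m) (0<small m))

-- The merge cost of the hard inputs

-- L = 9^a 2^a is what one splitting step loses (3^m ≤ 9 · 27^(m/3) and
-- 2(m/3) ≤ p + 1); the induction hypothesis is strengthened by it.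
module HardCostBound (a b : ℕ) (27^a≤2^[2a+3b] : 27 ^ a ≤ 2 ^ (2 * a + 3 * b)) where

  L : ℕ
  L = 18 ^ a

  M : ℕ
  M = L * 5 ^ a

  small-input-bound : ∀ m → 1 ≤ m → m ≤ 5 → (m ^ m) ^ a * L ≤ 2 ^ (b * 0) * M ^ m
  small-input-bound m@(suc k) _ m≤5 rewrite *-zeroʳ b = begin
    (m ^ m) ^ a * L       ≡⟨ cong (_* L) ([m^n]^o≡[m^o]^n m m a) ⟩
    (m ^ a) ^ m * L       ≤⟨ *-mono-≤ (^-monoˡ-≤ m (^-monoˡ-≤ a m≤5)) L≤Lᵐ ⟩
    (5 ^ a) ^ m * L ^ m   ≡⟨ *-comm ((5 ^ a) ^ m) (L ^ m) ⟩
    L ^ m * (5 ^ a) ^ m   ≡⟨ ^-distribʳ-* L (5 ^ a) m ⟨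
    M ^ m                 ≡⟨ +-identityʳ _ ⟨
    1 * M ^ m             ∎
    where
      open ≤-Reasoning
      L≤Lᵐ : L ≤ L ^ m
      L≤Lᵐ = m≤m*n L (L ^ k) {{m^n≢0 L k {{m^n≢0 18 a}}}}

  [3^m]^a-bound : ∀ {m} → 6 ≤ m → (3 ^ m) ^ a ≤ 2 ^ (b * m) * (L * (2 ^ large m) ^ a)
  [3^m]^a-bound {m} 6≤m = begin
    (3 ^ m) ^ a                               ≤⟨ ^-monoˡ-≤ a (3^m≤9*27^[m/3] 6≤m) ⟩
    (9 * 27 ^ k) ^ a                          ≡⟨ ^-distribʳ-* 9 (27 ^ k) a ⟩
    9 ^ a * (27 ^ k) ^ a                      ≡⟨ cong (9 ^ a *_) ([m^n]^o≡[m^o]^n 27 k a) ⟩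
    9 ^ a * (27 ^ a) ^ k                      ≤⟨ *-monoʳ-≤ (9 ^ a) (^-monoˡ-≤ k 27^a≤2^[2a+3b]) ⟩
    9 ^ a * (2 ^ (2 * a + 3 * b)) ^ k         ≡⟨ cong (9 ^ a *_) (^-*-assoc 2 (2 * a + 3 * b) k) ⟩
    9 ^ a * 2 ^ ((2 * a + 3 * b) * k)         ≤⟨ *-monoʳ-≤ (9 ^ a) (^-monoʳ-≤ 2 exponent-bound) ⟩
    9 ^ a * 2 ^ (b * m + (a + p * a))         ≡⟨ cong (9 ^ a *_) (^-distribˡ-+-* 2 (b * m) (a + p * a)) ⟩
    9 ^ a * (2 ^ (b * m) * 2 ^ (a + p * a))   ≡⟨ cong (λ t → 9 ^ a * (2 ^ (b * m) * t)) (^-distribˡ-+-* 2 a (p * a)) ⟩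
    9 ^ a * (2 ^ (b * m) * (2 ^ a * 2 ^ (p * a))) ≡⟨ regroup (9 ^ a) (2 ^ (b * m)) (2 ^ a) (2 ^ (p * a)) ⟩
    2 ^ (b * m) * (9 ^ a * 2 ^ a * 2 ^ (p * a))   ≡⟨ cong₂ (λ s t → 2 ^ (b * m) * (s * t)) (^-distribʳ-* 9 2 a) (^-*-assoc 2 p a) ⟨
    2 ^ (b * m) * (L * (2 ^ p) ^ a)           ∎
    where
      open ≤-Reasoning
      k = m / 3
      p = large m
      regroup : ∀ A B C D → A * (B * (C * D)) ≡ B * (A * C * D)
      regroup = solve-∀
      exponent-bound : (2 * a + 3 * b) * k ≤ b * m + (a + p * a)
      exponent-bound = begin
        (2 * a + 3 * b) * k       ≡⟨ distrib a b k ⟩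
        b * (3 * k) + a * (2 * k) ≤⟨ +-mono-≤ (*-monoʳ-≤ b (3*[m/3]≤m 6≤m)) (*-monoʳ-≤ a (2*[m/3]≤large+1 6≤m)) ⟩
        b * m + a * (p + 1)       ≡⟨ cong (b * m +_) (distrib′ a p) ⟩
        b * m + (a + p * a)       ∎
        where
          distrib : ∀ a b k → (2 * a + 3 * b) * k ≡ b * (3 * k) + a * (2 * k)
          distrib = solve-∀
          distrib′ : ∀ a p → a * (p + 1) ≡ a + p * a
          distrib′ = solve-∀

  split-bound : ∀ {m} → 6 ≤ m → let p = large m; q = small m in
    (m ^ m) ^ a ≤ 2 ^ (b * m) * L * ((p ^ p) ^ a * (q ^ q) ^ a)
  split-bound {m} 6≤m = *-cancelʳ-≤ _ _ T {{m^n≢0 (2 ^ p) a {{m^n≢0 2 p}}}} (begin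
    (m ^ m) ^ a * T                           ≡⟨ ^-distribʳ-* (m ^ m) (2 ^ p) a ⟨
    (m ^ m * 2 ^ p) ^ a                       ≤⟨ ^-monoˡ-≤ a entropy ⟩
    (3 ^ m * (p ^ p * q ^ q)) ^ a             ≡⟨ ^-distribʳ-* (3 ^ m) (p ^ p * q ^ q) a ⟩
    (3 ^ m) ^ a * (p ^ p * q ^ q) ^ a         ≡⟨ cong ((3 ^ m) ^ a *_) (^-distribʳ-* (p ^ p) (q ^ q) a) ⟩
    (3 ^ m) ^ a * P                           ≤⟨ *-monoˡ-≤ P ([3^m]^a-bound 6≤m) ⟩
    2 ^ (b * m) * (L * T) * P                 ≡⟨ regroup (2 ^ (b * m)) L T P ⟩
    2 ^ (b * m) * L * P * T                   ∎)
    where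
      open ≤-Reasoning
      p = large m
      q = small m
      T = (2 ^ p) ^ a
      P = (p ^ p) ^ a * (q ^ q) ^ a
      q+p≡m : q + p ≡ m
      q+p≡m = trans (+-comm q p) (large+small≡m 6≤m)
      entropy : m ^ m * 2 ^ p ≤ 3 ^ m * (p ^ p * q ^ q)
      entropy = subst (λ n → n ^ n * 2 ^ p ≤ 3 ^ n * (p ^ p * q ^ q)) q+p≡m
        (entropy-bound q p (0<small m) (0<large 6≤m))
      regroup : ∀ B L T P → B * (L * T) * P ≡ B * L * P * T
      regroup = solve-∀

  hardCost-bound : ∀ f m → 1 ≤ m → m ≤ f → (m ^ m) ^ a * L ≤ 2 ^ (b * hardCost f m) * M ^ m
  hardCost-bound zero    (suc _) _ ()
  hardCost-bound (suc f) m 1≤m m≤1+f with m <? 6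
  ... | yes m<6 = small-input-bound m 1≤m (≤-pred m<6)
  ... | no m≮6 = begin
    (m ^ m) ^ a * L                                   ≤⟨ *-monoˡ-≤ L (split-bound 6≤m) ⟩
    2 ^ (b * m) * L * ((p ^ p) ^ a * (q ^ q) ^ a) * L ≡⟨ regroup (2 ^ (b * m)) L ((p ^ p) ^ a) ((q ^ q) ^ a) ⟩
    2 ^ (b * m) * (((p ^ p) ^ a * L) * ((q ^ q) ^ a * L))
      ≤⟨ *-monoʳ-≤ (2 ^ (b * m)) (*-mono-≤ (hardCost-bound f p (0<large 6≤m) p≤f) (hardCost-bound f q (0<small m) q≤f)) ⟩
    2 ^ (b * m) * ((2 ^ (b * Cp) * M ^ p) * (2 ^ (b * Cq) * M ^ q))
      ≡⟨ regroup′ (2 ^ (b * m)) (2 ^ (b * Cp)) (M ^ p) (2 ^ (b * Cq)) (M ^ q) ⟩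
    (2 ^ (b * Cp) * 2 ^ (b * Cq) * 2 ^ (b * m)) * (M ^ p * M ^ q)
      ≡⟨ cong₂ _*_ (sym 2^-split) (trans (sym (^-distribˡ-+-* M p q)) (cong (M ^_) (large+small≡m 6≤m))) ⟩
    2 ^ (b * (Cp + Cq + m)) * M ^ m                   ∎
    where
      open ≤-Reasoning
      6≤m : 6 ≤ m
      6≤m = ≮⇒≥ m≮6
      p = large m
      q = small m
      Cp = hardCost f p
      Cq = hardCost f q
      p≤f : p ≤ f
      p≤f = ≤-pred (≤-trans (large<m 6≤m) m≤1+f)
      q≤f : q ≤ f
      q≤f = ≤-pred (≤-trans (small<m 6≤m) m≤1+f)
      regroup : ∀ B L X Y → B * L * (X * Y) * L ≡ B * ((X * L) * (Y * L))
      regroup = solve-∀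
      regroup′ : ∀ B x y z w → B * ((x * y) * (z * w)) ≡ (x * z * B) * (y * w)
      regroup′ = solve-∀
      2^-split : 2 ^ (b * (Cp + Cq + m)) ≡ 2 ^ (b * Cp) * 2 ^ (b * Cq) * 2 ^ (b * m)
      2^-split = begin-equality
        2 ^ (b * (Cp + Cq + m))                   ≡⟨ cong (2 ^_) (distrib b Cp Cq m) ⟩
        2 ^ ((b * Cp + b * Cq) + b * m)           ≡⟨ ^-distribˡ-+-* 2 (b * Cp + b * Cq) (b * m) ⟩
        2 ^ (b * Cp + b * Cq) * 2 ^ (b * m)       ≡⟨ cong (_* 2 ^ (b * m)) (^-distribˡ-+-* 2 (b * Cp) (b * Cq)) ⟩
        2 ^ (b * Cp) * 2 ^ (b * Cq) * 2 ^ (b * m) ∎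
        where
          distrib : ∀ b x y m → b * (x + y + m) ≡ (b * x + b * y) + b * m
          distrib = solve-∀

bernoulli : ∀ x s → x ^ s * (x + s) ≤ (x + 1) ^ s * x
bernoulli x zero = ≤-reflexive (base x)
  where
    base : ∀ x → 1 * (x + 0) ≡ 1 * x
    base = solve-∀
bernoulli x (suc s) = begin
  x * x ^ s * (x + suc s)        ≤⟨ m≤m+n _ (s * x ^ s) ⟩
  x * x ^ s * (x + suc s) + s * x ^ s ≡⟨ regroup x s (x ^ s) ⟩
  (x + 1) * (x ^ s * (x + s))    ≤⟨ *-monoʳ-≤ (x + 1) (bernoulli x s) ⟩
  (x + 1) * ((x + 1) ^ s * x)    ≡⟨ *-assoc (x + 1) _ x ⟨
  (x + 1) * (x + 1) ^ s * x      ∎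
  where
    open ≤-Reasoning
    regroup : ∀ x s X → x * X * (x + suc s) + s * X ≡ (x + 1) * (X * (x + s))
    regroup = solve-∀

-- With x = 27^a and t = 7x, Bernoulli gives 8 x^t ≤ (x + 1)^t: raising the
-- strict inequality to the t-th power gains a factor 8, which pays for 27 ≤ 4 · 8.
amplify : ∀ a b → 27 ^ a < 2 ^ (2 * a + 3 * b) → let t = 7 * 27 ^ a in
  27 ^ (a * t + 1) ≤ 2 ^ (2 * (a * t + 1) + 3 * (b * t))
amplify a b 27^a<2^[2a+3b] = begin
  27 ^ (a * t + 1)          ≡⟨ ^-distribˡ-+-* 27 (a * t) 1 ⟩
  27 ^ (a * t) * 27 ^ 1     ≡⟨ cong (_* 27 ^ 1) (^-*-assoc 27 a t) ⟨
  x ^ t * 27                ≤⟨ *-monoʳ-≤ (x ^ t) (m≤m+n 27 5) ⟩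
  x ^ t * 32                ≡⟨ regroup (x ^ t) ⟩
  4 * (x ^ t * 8)           ≤⟨ *-monoʳ-≤ 4 8xᵗ≤[x+1]ᵗ ⟩
  4 * (x + 1) ^ t           ≤⟨ *-monoʳ-≤ 4 (^-monoˡ-≤ t (≤-trans (≤-reflexive (+-comm x 1)) 27^a<2^[2a+3b])) ⟩
  4 * (2 ^ (2 * a + 3 * b)) ^ t ≡⟨ cong (4 *_) (^-*-assoc 2 (2 * a + 3 * b) t) ⟩
  2 ^ 2 * 2 ^ ((2 * a + 3 * b) * t) ≡⟨ ^-distribˡ-+-* 2 2 ((2 * a + 3 * b) * t) ⟨
  2 ^ (2 + (2 * a + 3 * b) * t) ≡⟨ cong (2 ^_) (distrib a b t) ⟩
  2 ^ (2 * (a * t + 1) + 3 * (b * t)) ∎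
  where
    open ≤-Reasoning
    x = 27 ^ a
    t = 7 * x
    regroup : ∀ X → X * 32 ≡ 4 * (X * 8)
    regroup = solve-∀
    distrib : ∀ a b t → 2 + (2 * a + 3 * b) * t ≡ 2 * (a * t + 1) + 3 * (b * t)
    distrib = solve-∀
    regroup′ : ∀ X x → X * (x + 7 * x) ≡ X * 8 * x
    regroup′ = solve-∀
    8xᵗ≤[x+1]ᵗ : x ^ t * 8 ≤ (x + 1) ^ t
    8xᵗ≤[x+1]ᵗ = *-cancelʳ-≤ (x ^ t * 8) ((x + 1) ^ t) x {{m^n≢0 27 a}}
      (≤-trans (≤-reflexive (sym (regroup′ (x ^ t) x))) (bernoulli x t))

-- For the amplified pair (a t + 1, b t) the left side of hardCost-bound is
-- (n^(an))^t n^n; the factor n^n absorbs M^n once n ≥ M, then take t-th roots.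
hardCost-large : ∀ a b → 27 ^ a < 2 ^ (2 * a + 3 * b) →
  ∃[ n₀ ] ∀ n → n₀ ≤ n → n ^ (a * n) ≤ 2 ^ (b * hardCost n n)
hardCost-large a b 27^a<2^[2a+3b] = suc M , bound
  where
    t = 7 * 27 ^ a
    open HardCostBound (a * t + 1) (b * t) (amplify a b 27^a<2^[2a+3b])
    instance
      t≢0 : NonZero t
      t≢0 = m*n≢0 7 (27 ^ a) {{_}} {{m^n≢0 27 a}}
    bound : ∀ n → suc M ≤ n → n ^ (a * n) ≤ 2 ^ (b * hardCost n n)
    bound n@(suc _) 1+M≤n = ^-cancelʳ-≤ t (*-cancelʳ-≤ _ _ (n ^ n) {{m^n≢0 n n}} (begin
      (n ^ (a * n)) ^ t * n ^ n                 ≡⟨ cong (_* n ^ n) (^-*-assoc n (a * n) t) ⟩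
      n ^ (a * n * t) * n ^ n                   ≡⟨ ^-distribˡ-+-* n (a * n * t) n ⟨
      n ^ (a * n * t + n)                       ≡⟨ cong (n ^_) (regroup a n t) ⟩
      n ^ (n * (a * t + 1))                     ≡⟨ ^-*-assoc n n (a * t + 1) ⟨
      (n ^ n) ^ (a * t + 1)                     ≤⟨ m≤m*n _ L {{m^n≢0 18 (a * t + 1)}} ⟩
      (n ^ n) ^ (a * t + 1) * L                 ≤⟨ hardCost-bound n n (s≤s z≤n) ≤-refl ⟩
      2 ^ (b * t * C) * M ^ n                   ≤⟨ *-monoʳ-≤ (2 ^ (b * t * C)) (^-monoˡ-≤ n (≤-trans (n≤1+n M) 1+M≤n)) ⟩
      2 ^ (b * t * C) * n ^ n                   ≡⟨ cong (λ e → 2 ^ e * n ^ n) (swap b t C) ⟩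
      2 ^ (b * C * t) * n ^ n                   ≡⟨ cong (_* n ^ n) (^-*-assoc 2 (b * C) t) ⟨
      (2 ^ (b * C)) ^ t * n ^ n                 ∎))
      where
        open ≤-Reasoning
        C = hardCost n n
        regroup : ∀ a n t → a * n * t + n ≡ n * (a * t + 1)
        regroup = solve-∀
        swap : ∀ b t C → b * t * C ≡ b * C * t
        swap = solve-∀

theorem11 : (a b : ℕ) → 1 ≤ b → 27 ^ a < 2 ^ (2 * a + 3 * b) →
    (N : ℕ) → ∃[ runs ] (All (λ r → 1 ≤ r) runs × N ≤ sum runs ×
      sum runs ^ (a * sum runs) ≤ 2 ^ (b * twoMergeCost runs))
theorem11 a b _ 27^a<2^[2a+3b] N with hardCost-large a b 27^a<2^[2a+3b]
... | n₀ , bound =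
  hardRuns n n ,
  hardRuns-positive n n (s≤s z≤n) ,
  subst (N ≤_) (sym (sum-hardRuns n n)) N≤n ,
  subst₂ (λ s c → s ^ (a * s) ≤ 2 ^ (b * c)) (sym (sum-hardRuns n n)) (sym (twoMergeCost-hardRuns n n))
    (bound n n₀≤n)
  where
    n = suc (N + n₀)
    N≤n : N ≤ n
    N≤n = ≤-trans (m≤m+n N n₀) (n≤1+n _)
    n₀≤n : n₀ ≤ n
    n₀≤n = ≤-trans (m≤n+m n₀ N) (n≤1+n _)
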